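{- For a prime $p$, all $n,k_1,\dots,k_n\ge1$, all $\pi\in\Pi_n$ and all $\gamma^i\in\Pi_{k_i}$, $$H_p\bigl(\pi\circ(\gamma^1,\dots,\gamma^n)\bigr)=H_p(\pi)+\sum_{i=1}^n\pi_iH_p(\gamma^i).$$
   Context: $\Pi_n=\{\pi\in(\mathbb{Z}/p\mathbb{Z})^n:\pi_1+\cdots+\pi_n=1\}$. $H_p(\pi)=\frac1p(1-\sum_i a_i^p)\in\mathbb{Z}/p\mathbb{Z}$ where $a_i\in\mathbb{Z}$ represents $\pi_i$ (independent of choices). For $\gamma^i=(\gamma^i_1,\dots,\gamma^i_{k_i})$, $\pi\circ(\gamma^1,\dots,\gamma^n)=(\pi_1\gamma^1_1,\dots,\pi_1\gamma^1_{k_1},\dots,\pi_n\gamma^n_1,\dots,\pi_n\gamma^n_{k_n})\in\Pi_{k_1+\cdots+k_n}$. -}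

module Defs where

open import Data.Nat as ℕ using (ℕ; zero; suc; NonZero)
open import Data.Fin using (Fin; zero; suc; toℕ; fromℕ<)
open import Data.Vec using (Vec; []; _∷_; _++_; map; foldr; tabulate; lookup)
open import Data.Integer as ℤ using (ℤ; +_; 1ℤ; 0ℤ)
open import Data.Integer.DivMod using (_%ℕ_; n%ℕd<d; _/_)
open import Relation.Binary.PropositionalEquality using (_≡_)

-- ℤ/pℤ, represented by Fin p (canonical representatives 0 … p-1).
ZMod : ℕ → Set
ZMod p = Fin p

module _ {p : ℕ} .{{_ : NonZero p}} where

  [_] : ℤ → ZMod p
  [ a ] = fromℕ< (n%ℕd<d a p)

  rep : ZMod p → ℤ
  rep a = + toℕ a

  infixl 6 _⊕_
  infixl 7 _⊗_
  _⊕_ : ZMod p → ZMod p → ZMod p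
  a ⊕ b = [ rep a ℤ.+ rep b ]

  _⊗_ : ZMod p → ZMod p → ZMod p
  a ⊗ b = [ rep a ℤ.* rep b ]

  𝟙 : ZMod p
  𝟙 = [ 1ℤ ]

  Σp : ∀ {m} → Vec (ZMod p) m → ZMod p
  Σp = foldr _ _⊕_ [ 0ℤ ]

  InΠ : ∀ {m} → Vec (ZMod p) m → Set
  InΠ π = Σp π ≡ 𝟙

  sumPow : ∀ {m} → Vec (ZMod p) m → ℤ
  sumPow = foldr _ (λ a s → rep a ℤ.^ p ℤ.+ s) 0ℤ

  -- H_p(π) = (1 - Σ a_i^p) / p  reduced mod p
  -- (the division is exact for π ∈ Π_m by Fermat's little theorem)
  H : ∀ {m} → Vec (ZMod p) m → ZMod p
  H π = [ (1ℤ ℤ.- sumPow π) / (+ p) ]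

totalLen : (n : ℕ) → (Fin n → ℕ) → ℕ
totalLen zero    k = 0
totalLen (suc n) k = k zero ℕ.+ totalLen n (λ i → k (suc i))

compose : ∀ {p} .{{_ : NonZero p}} {n} → Vec (ZMod p) n →
          (k : Fin n → ℕ) → ((i : Fin n) → Vec (ZMod p) (k i)) →
          Vec (ZMod p) (totalLen n k)
compose []      k γ = []
compose (a ∷ π) k γ = map (a ⊗_) (γ zero) ++ compose π (λ i → k (suc i)) (λ i → γ (suc i))

-- Write S(v) = Σ_j a_j^p for the representatives a_j of the entries of v, so that p·H(v) lifts
-- 1 − S(v). If x ≡ y (mod p) then x^p ≡ y^p (mod p²), hence
-- S(π ∘ (γ^1, …, γ^n)) ≡ Σ_i a_i^p S(γ^i) (mod p²). Substituting S(γ^i) = 1 − p h_i with h_i a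
-- lift of H(γ^i) gives 1 − S(π ∘ γ) ≡ (1 − S(π)) + p Σ_i a_i^p h_i (mod p²); dividing by p and
-- using Fermat's little theorem a_i^p ≡ a_i (mod p) yields the formula. Fermat itself comes from
-- (x + y)^p ≡ x^p + y^p (mod p), since p divides every inner binomial coefficient C(p, k).
module Submission where

open import Defs
open import Data.Nat as ℕ using (ℕ; zero; suc; NonZero; _≤_; _∸_)
import Data.Nat.Properties as ℕP
open import Data.Nat.Combinatorics using (_C_; nC1≡n; nCn≡1; nCk+nC[k+1]≡[n+1]C[k+1])
open import Data.Nat.Divisibility using (∣⇒≤; >⇒∤) renaming (_∣_ to _∣ℕ_; divides to dividesℕ)
open import Data.Nat.DivMod using (m<n⇒m%n≡m)
open import Data.Nat.Primality using (Prime; euclidsLemma)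
import Data.Nat.Tactic.RingSolver as ℕ-Solver
open import Data.Fin using (Fin; zero; suc; toℕ; fromℕ; inject₁)
open import Data.Fin.Properties using (toℕ-fromℕ; toℕ-fromℕ<; toℕ-inject₁; toℕ<n; toℕ-injective)
open import Data.Vec using (Vec; []; _∷_; _++_; map; lookup; tabulate)
import Data.Integer.Properties as ℤP
open import Data.Integer.DivMod using (_/_; _%ℕ_; _/ℕ_; n%ℕd<d; a≡a%ℕn+[a/ℕn]*n; div-pos-is-/ℕ)
open import Data.Integer.Divisibility.Signed
  using (_∣_; divides; ∣-refl; ∣-trans; ∣ᵤ⇒∣; ∣⇒∣ᵤ; ∣m∣n⇒∣m+n; ∣m⇒∣-m; ∣m⇒∣m*n; ∣n⇒∣m*n;
         *-monoˡ-∣; *-monoʳ-∣; *-cancelʳ-∣)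
open import Data.Integer.Tactic.RingSolver using (solve-∀)
open import Data.Sum using (inj₁; inj₂)
open import Algebra.Properties.Monoid.Sum ℤP.+-0-monoid using (sum; sum-syntax; sum-init-last; sum-cong-≗)
open import Algebra.Properties.Monoid.Mult ℤP.+-0-monoid using (_×_)
open import Algebra.Properties.CommutativeSemiring.Binomial ℤP.+-*-commutativeSemiring
  using (binomialTerm) renaming (theorem to binomialTheorem)
import Algebra.Properties.CommutativeSemiring.Exp ℤP.+-*-commutativeSemiring as Exp
open Exp using () renaming (_^_ to _^ᴿ_)
open import Function using (_∘_)
open import Relation.Nullary using (contradiction)
open import Relation.Binary.Bundles using (Setoid)
open import Relation.Binary.Structures using (IsEquivalence)
open import Relation.Binary.PropositionalEquality
  using (_≡_; refl; sym; trans; cong; cong₂; subst; module ≡-Reasoning)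

-- ℕ arithmetic is opened only in this block; everywhere else _+_, _*_ are those of ℤ.
module _ where

  open import Data.Nat using (_+_; _*_)

  [k+1]*[n+1]C[k+1]≡[n+1]*nCk : ∀ n k → suc k * (suc n C suc k) ≡ suc n * (n C k)
  [k+1]*[n+1]C[k+1]≡[n+1]*nCk zero    zero    = refl
  [k+1]*[n+1]C[k+1]≡[n+1]*nCk zero    (suc k) = ℕP.*-zeroʳ (suc (suc k))
  [k+1]*[n+1]C[k+1]≡[n+1]*nCk (suc n) zero    =
    trans (ℕP.+-identityʳ _) (trans (nC1≡n (2 + n)) (sym (ℕP.*-identityʳ (2 + n))))
  [k+1]*[n+1]C[k+1]≡[n+1]*nCk (suc n) (suc k) = begin
    (2 + k) * ((2 + n) C (2 + k))
      ≡⟨ cong ((2 + k) *_) (nCk+nC[k+1]≡[n+1]C[k+1] (suc n) (suc k)) ⟨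
    (2 + k) * ((1 + n) C (1 + k) + (1 + n) C (2 + k))
      ≡⟨ lemma₁ (suc k) ((1 + n) C (1 + k)) ((1 + n) C (2 + k)) ⟩
    (1 + k) * ((1 + n) C (1 + k)) + (1 + n) C (1 + k) + (2 + k) * ((1 + n) C (2 + k))
      ≡⟨ cong₂ (λ a b → a + (1 + n) C (1 + k) + b)
               ([k+1]*[n+1]C[k+1]≡[n+1]*nCk n k) ([k+1]*[n+1]C[k+1]≡[n+1]*nCk n (suc k)) ⟩
    (1 + n) * (n C k) + (1 + n) C (1 + k) + (1 + n) * (n C (1 + k))
      ≡⟨ lemma₂ n (n C k) (n C (1 + k)) ((1 + n) C (1 + k)) ⟩
    (1 + n) * (n C k + n C (1 + k)) + (1 + n) C (1 + k)
      ≡⟨ cong (λ a → (1 + n) * a + (1 + n) C (1 + k)) (nCk+nC[k+1]≡[n+1]C[k+1] n k) ⟩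
    (1 + n) * ((1 + n) C (1 + k)) + (1 + n) C (1 + k)
      ≡⟨ lemma₃ n ((1 + n) C (1 + k)) ⟩
    (2 + n) * ((1 + n) C (1 + k))  ∎
    where
      open ≡-Reasoning
      lemma₁ : ∀ k a b → suc k * (a + b) ≡ k * a + a + suc k * b
      lemma₁ = ℕ-Solver.solve-∀
      lemma₂ : ∀ n a b c → suc n * a + c + suc n * b ≡ suc n * (a + b) + c
      lemma₂ = ℕ-Solver.solve-∀
      lemma₃ : ∀ n c → suc n * c + c ≡ suc (suc n) * c
      lemma₃ = ℕ-Solver.solve-∀

  prime∣pCk : ∀ {p k} → Prime p → 0 ℕ.< k → k ℕ.< p → p ∣ℕ p C k
  prime∣pCk {suc q} {suc j} p-prime _ k<p
    with euclidsLemma (suc j) (suc q C suc j) p-prime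
           (dividesℕ (q C j) (trans ([k+1]*[n+1]C[k+1]≡[n+1]*nCk q j) (ℕP.*-comm (suc q) (q C j))))
  ... | inj₁ p∣k   = contradiction (∣⇒≤ p∣k) (ℕP.<⇒≱ k<p)
  ... | inj₂ p∣pCk = p∣pCk

open import Data.Integer as ℤ using (ℤ; +_; 0ℤ; 1ℤ; _+_; _*_; -_; _-_; _^_; _⊖_)

-- A record rather than a synonym for m ∣ x - y, so that x and y can be inferred.
infix 4 _≡_[mod_]
record _≡_[mod_] (x y m : ℤ) : Set where
  constructor ≡[mod]
  field divides-difference : m ∣ x - y

*-pres-∣ : ∀ {i j a b} → i ∣ a → j ∣ b → i * j ∣ a * b
*-pres-∣ {j = j} {a} i∣a j∣b = ∣-trans (*-monoˡ-∣ j i∣a) (*-monoʳ-∣ a j∣b)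

module _ {m : ℤ} where

  ≡[mod]-by : ∀ {x y z} → x - y ≡ z → m ∣ z → x ≡ y [mod m ]
  ≡[mod]-by eq m∣z = ≡[mod] (subst (m ∣_) (sym eq) m∣z)

  ≡⇒≡[mod] : ∀ {x y} → x ≡ y → x ≡ y [mod m ]
  ≡⇒≡[mod] {x} refl = ≡[mod] (divides 0ℤ (ℤP.+-inverseʳ x))

  ∣⇒≡0[mod] : ∀ {x} → m ∣ x → x ≡ 0ℤ [mod m ]
  ∣⇒≡0[mod] {x} = ≡[mod]-by (ℤP.+-identityʳ x)

  ≡[mod]-sym : ∀ {x y} → x ≡ y [mod m ] → y ≡ x [mod m ]
  ≡[mod]-sym {x} {y} (≡[mod] m∣x-y) = ≡[mod]-by (lemma x y) (∣m⇒∣-m m∣x-y)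
    where lemma : ∀ x y → y - x ≡ - (x - y)
          lemma = solve-∀

  ≡[mod]-trans : ∀ {x y z} → x ≡ y [mod m ] → y ≡ z [mod m ] → x ≡ z [mod m ]
  ≡[mod]-trans {x} {y} {z} (≡[mod] m∣x-y) (≡[mod] m∣y-z) =
    ≡[mod]-by (lemma x y z) (∣m∣n⇒∣m+n m∣x-y m∣y-z)
    where lemma : ∀ x y z → x - z ≡ (x - y) + (y - z)
          lemma = solve-∀

  ≡[mod]-isEquivalence : IsEquivalence _≡_[mod m ]
  ≡[mod]-isEquivalence = record { refl = ≡⇒≡[mod] refl ; sym = ≡[mod]-sym ; trans = ≡[mod]-trans }

  ≡[mod]-∣ : ∀ {n x y} → m ∣ n → x ≡ y [mod n ] → x ≡ y [mod m ]
  ≡[mod]-∣ m∣n (≡[mod] n∣x-y) = ≡[mod] (∣-trans m∣n n∣x-y)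

  +-cong[mod] : ∀ {x y u v} → x ≡ y [mod m ] → u ≡ v [mod m ] → x + u ≡ y + v [mod m ]
  +-cong[mod] {x} {y} {u} {v} (≡[mod] m∣x-y) (≡[mod] m∣u-v) =
    ≡[mod]-by (lemma x y u v) (∣m∣n⇒∣m+n m∣x-y m∣u-v)
    where lemma : ∀ x y u v → (x + u) - (y + v) ≡ (x - y) + (u - v)
          lemma = solve-∀

  *-cong[mod] : ∀ {x y u v} → x ≡ y [mod m ] → u ≡ v [mod m ] → x * u ≡ y * v [mod m ]
  *-cong[mod] {x} {y} {u} {v} (≡[mod] m∣x-y) (≡[mod] m∣u-v) =
    ≡[mod]-by (lemma x y u v) (∣m∣n⇒∣m+n (∣m⇒∣m*n u m∣x-y) (∣n⇒∣m*n y m∣u-v))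
    where lemma : ∀ x y u v → x * u - y * v ≡ (x - y) * u + y * (u - v)
          lemma = solve-∀

  -‿cong[mod] : ∀ {x y} → x ≡ y [mod m ] → - x ≡ - y [mod m ]
  -‿cong[mod] {x} {y} (≡[mod] m∣x-y) = ≡[mod]-by (lemma x y) (∣m⇒∣-m m∣x-y)
    where lemma : ∀ x y → - x - - y ≡ - (x - y)
          lemma = solve-∀

  +-congˡ[mod] : ∀ x {u v} → u ≡ v [mod m ] → x + u ≡ x + v [mod m ]
  +-congˡ[mod] x = +-cong[mod] (≡⇒≡[mod] {x = x} refl)

  *-congˡ[mod] : ∀ x {u v} → u ≡ v [mod m ] → x * u ≡ x * v [mod m ]
  *-congˡ[mod] x = *-cong[mod] (≡⇒≡[mod] {x = x} refl)

  *-cancelʳ-≡[mod] : ∀ k .{{_ : ℤ.NonZero k}} {x y} → x * k ≡ y * k [mod m * k ] → x ≡ y [mod m ]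
  *-cancelʳ-≡[mod] k {x} {y} (≡[mod] mk∣xk-yk) =
    ≡[mod] (*-cancelʳ-∣ k (subst (m * k ∣_) (lemma k x y) mk∣xk-yk))
    where lemma : ∀ k x y → x * k - y * k ≡ (x - y) * k
          lemma = solve-∀

≡[mod]-setoid : ℤ → Setoid _ _
≡[mod]-setoid m = record { isEquivalence = ≡[mod]-isEquivalence {m} }

module _ {m : ℤ} where

  ^-suc-≡[mod²] : ∀ {x y} → x ≡ y [mod m ] → ∀ n →
                  x ^ suc n ≡ y ^ suc n + + suc n * y ^ n * (x - y) [mod m * m ]
  ^-suc-≡[mod²] {x} {y} _ zero = ≡⇒≡[mod] (lemma x y)
    where lemma : ∀ x y → x * 1ℤ ≡ y * 1ℤ + 1ℤ * 1ℤ * (x - y)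
          lemma = solve-∀
  ^-suc-≡[mod²] {x} {y} x≡y@(≡[mod] m∣x-y) (suc n) = begin
    x * x ^ suc n                            ≈⟨ *-congˡ[mod] x (^-suc-≡[mod²] x≡y n) ⟩
    x * (y ^ suc n + c * y ^ n * (x - y))    ≡⟨ lemma x y (y ^ n) c ⟩
    linear + c * y ^ n * ((x - y) * (x - y)) ≈⟨ +-congˡ[mod] linear m²∣quadratic ⟩
    linear + 0ℤ                              ≡⟨ ℤP.+-identityʳ linear ⟩
    linear                                   ∎
    where
      open import Relation.Binary.Reasoning.Setoid (≡[mod]-setoid (m * m))
      c = + suc n
      linear = y ^ suc (suc n) + (1ℤ + c) * y ^ suc n * (x - y)
      m²∣quadratic : c * y ^ n * ((x - y) * (x - y)) ≡ 0ℤ [mod m * m ]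
      m²∣quadratic = ∣⇒≡0[mod] (∣n⇒∣m*n (c * y ^ n) (*-pres-∣ m∣x-y m∣x-y))
      lemma : ∀ x y Y c → x * (y * Y + c * Y * (x - y)) ≡
                          y * (y * Y) + (1ℤ + c) * (y * Y) * (x - y) + c * Y * ((x - y) * (x - y))
      lemma = solve-∀

  ^-cong[mod²] : ∀ {x y} n → m ∣ + n → x ≡ y [mod m ] → x ^ n ≡ y ^ n [mod m * m ]
  ^-cong[mod²] zero _ _ = ≡⇒≡[mod] refl
  ^-cong[mod²] {x} {y} (suc n) m∣n x≡y@(≡[mod] m∣x-y) = begin
    x ^ suc n                              ≈⟨ ^-suc-≡[mod²] x≡y n ⟩
    y ^ suc n + + suc n * y ^ n * (x - y)  ≈⟨ +-congˡ[mod] (y ^ suc n) (∣⇒≡0[mod] m²∣linear) ⟩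
    y ^ suc n + 0ℤ                         ≡⟨ ℤP.+-identityʳ (y ^ suc n) ⟩
    y ^ suc n                              ∎
    where
      open import Relation.Binary.Reasoning.Setoid (≡[mod]-setoid (m * m))
      m²∣linear : m * m ∣ + suc n * y ^ n * (x - y)
      m²∣linear = *-pres-∣ (∣m⇒∣m*n (y ^ n) m∣n) m∣x-y

∣-sum : ∀ {m n} (t : Fin n → ℤ) → (∀ i → m ∣ t i) → m ∣ sum t
∣-sum {n = zero}  t _   = divides 0ℤ refl
∣-sum {n = suc n} t m∣t = ∣m∣n⇒∣m+n (m∣t zero) (∣-sum (t ∘ suc) (m∣t ∘ suc))

×≡* : ∀ n x → n × x ≡ + n * x
×≡* zero    x = refl
×≡* (suc n) x = trans (cong (_+_ x) (×≡* n x)) (sym (ℤP.suc-* (+ n) x))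

-- The library's binomial theorem and power laws are about the semiring power _^ᴿ_, which agrees
-- with ℤ's _^_ only propositionally.
^ᴿ≡^ : ∀ x n → x ^ᴿ n ≡ x ^ n
^ᴿ≡^ x zero    = refl
^ᴿ≡^ x (suc n) = cong (x *_) (^ᴿ≡^ x n)

^-distrib-* : ∀ x y n → (x * y) ^ n ≡ x ^ n * y ^ n
^-distrib-* x y n = begin
  (x * y) ^ n      ≡⟨ ^ᴿ≡^ (x * y) n ⟨
  (x * y) ^ᴿ n     ≡⟨ Exp.^-distrib-* x y n ⟩
  x ^ᴿ n * y ^ᴿ n  ≡⟨ cong₂ _*_ (^ᴿ≡^ x n) (^ᴿ≡^ y n) ⟩
  x ^ n * y ^ n    ∎
  where open ≡-Reasoning

module _ (x y : ℤ) (q : ℕ) where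

  private
    p = suc q
    t = binomialTerm x y p

  binomialTerm-first : t zero ≡ y ^ᴿ p
  binomialTerm-first = trans (ℤP.+-identityʳ _) (ℤP.*-identityˡ _)

  binomialTerm-last : t (fromℕ p) ≡ x ^ᴿ p
  binomialTerm-last rewrite toℕ-fromℕ q | nCn≡1 p | ℕP.n∸n≡0 q =
    trans (ℤP.+-identityʳ _) (ℤP.*-identityʳ _)

  binomialTerm-inner : Prime p → ∀ (j : Fin q) → + p ∣ t (suc (inject₁ j))
  binomialTerm-inner p-prime j =
    subst (+ p ∣_) (sym (×≡* (p C k) xᵏyᵖ⁻ᵏ))
          (∣m⇒∣m*n xᵏyᵖ⁻ᵏ (∣ᵤ⇒∣ {+ p} {+ (p C k)} (prime∣pCk p-prime (ℕ.s≤s ℕ.z≤n) k<p)))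
    where
      k = suc (toℕ (inject₁ j))
      xᵏyᵖ⁻ᵏ = x ^ᴿ k * y ^ᴿ (p ∸ k)
      k<p : k ℕ.< p
      k<p = ℕ.s≤s (subst (ℕ._< q) (sym (toℕ-inject₁ j)) (toℕ<n j))

freshmansDream : ∀ {p} → Prime p → ∀ x y → (x + y) ^ p ≡ x ^ p + y ^ p [mod + p ]
freshmansDream {suc q} p-prime x y = begin
  (x + y) ^ p                         ≡⟨ ^ᴿ≡^ (x + y) p ⟨
  (x + y) ^ᴿ p                        ≡⟨ binomialTheorem p x y ⟩
  t zero + sum (t ∘ suc)              ≡⟨ cong (_+_ (t zero)) (sum-init-last (t ∘ suc)) ⟩
  t zero + (sum inner + t (fromℕ p))  ≈⟨ +-congˡ[mod] (t zero) (+-cong[mod] inner≡0 (≡⇒≡[mod] refl)) ⟩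
  t zero + (0ℤ + t (fromℕ p))         ≡⟨ cong₂ (λ a b → a + (0ℤ + b)) (binomialTerm-first x y q) (binomialTerm-last x y q) ⟩
  y ^ᴿ p + (0ℤ + x ^ᴿ p)              ≡⟨ cong₂ (λ a b → a + (0ℤ + b)) (^ᴿ≡^ y p) (^ᴿ≡^ x p) ⟩
  y ^ p + (0ℤ + x ^ p)                ≡⟨ cong (λ z → y ^ p + z) (ℤP.+-identityˡ (x ^ p)) ⟩
  y ^ p + x ^ p                       ≡⟨ ℤP.+-comm (y ^ p) (x ^ p) ⟩
  x ^ p + y ^ p                       ∎
  where
    open import Relation.Binary.Reasoning.Setoid (≡[mod]-setoid (+ suc q))
    p = suc q
    t = binomialTerm x y p
    inner : Fin q → ℤ
    inner j = t (suc (inject₁ j))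
    inner≡0 : sum inner ≡ 0ℤ [mod + p ]
    inner≡0 = ∣⇒≡0[mod] (∣-sum inner (binomialTerm-inner x y q p-prime))

fermat : ∀ {p} → Prime p → ∀ a → (+ a) ^ p ≡ + a [mod + p ]
fermat {suc q} p-prime zero    = ≡⇒≡[mod] refl
fermat {p}     p-prime (suc a) = begin
  (1ℤ + + a) ^ p      ≈⟨ freshmansDream p-prime 1ℤ (+ a) ⟩
  1ℤ ^ p + (+ a) ^ p  ≈⟨ +-cong[mod] (≡⇒≡[mod] (ℤP.^-zeroˡ p)) (fermat p-prime a) ⟩
  1ℤ + + a            ∎
  where open import Relation.Binary.Reasoning.Setoid (≡[mod]-setoid (+ p))

residue-unique : ∀ {p a b} → a ℕ.< p → b ℕ.< p → + a ≡ + b [mod + p ] → a ≡ b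
residue-unique {p} {a} {b} a<p b<p (≡[mod] p∣a-b) =
  ℤP.+-injective (ℤP.i-j≡0⇒i≡j (+ a) (+ b) (ℤP.∣i∣≡0⇒i≡0 (multiple-below⇒≡0 (∣⇒∣ᵤ p∣a-b) distance<p)))
  where
    multiple-below⇒≡0 : ∀ {m n} → m ∣ℕ n → n ℕ.< m → n ≡ 0
    multiple-below⇒≡0 {n = zero}  _   _   = refl
    multiple-below⇒≡0 {n = suc _} m∣n n<m = contradiction m∣n (>⇒∤ n<m)
    distance<p : ℤ.∣ + a - + b ∣ ℕ.< p
    distance<p = begin-strict
      ℤ.∣ + a - + b ∣  ≡⟨ cong ℤ.∣_∣ (ℤP.[+m]-[+n]≡m⊖n a b) ⟩
      ℤ.∣ a ⊖ b ∣      ≤⟨ ℤP.∣m⊝n∣≤m⊔n a b ⟩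
      a ℕ.⊔ b          <⟨ ℕP.⊔-pres-<m a<p b<p ⟩
      p                ∎
      where open ℕP.≤-Reasoning

sumPow-++ : ∀ {p} .{{_ : NonZero p}} {m n} (u : Vec (ZMod p) m) (w : Vec (ZMod p) n) →
            sumPow (u ++ w) ≡ sumPow u + sumPow w
sumPow-++     []      w = sym (ℤP.+-identityˡ (sumPow w))
sumPow-++ {p} (a ∷ u) w =
  trans (cong (_+_ (rep a ^ p)) (sumPow-++ u w)) (sym (ℤP.+-assoc (rep a ^ p) (sumPow u) (sumPow w)))

sumPow≡∑ : ∀ {p} .{{_ : NonZero p}} {n} (π : Vec (ZMod p) n) → sumPow π ≡ ∑[ i < n ] (rep (lookup π i) ^ p)
sumPow≡∑     []      = refl
sumPow≡∑ {p} (a ∷ π) = cong (_+_ (rep a ^ p)) (sumPow≡∑ π)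

∑-complement : ∀ {n} (m : ℤ) (c b : Fin n → ℤ) →
               ∑[ i < n ] (c i * (1ℤ - b i * m)) ≡ ∑[ i < n ] c i - ∑[ i < n ] (c i * b i) * m
∑-complement {zero}  m c b = refl
∑-complement {suc n} m c b =
  trans (cong (_+_ (c zero * (1ℤ - b zero * m))) (∑-complement m (c ∘ suc) (b ∘ suc)))
        (lemma (c zero) (b zero) (∑[ i < n ] c (suc i)) (∑[ i < n ] (c (suc i) * b (suc i))) m)
  where lemma : ∀ c b C B m → c * (1ℤ - b * m) + (C - B * m) ≡ c + C - (c * b + B) * m
        lemma = solve-∀

-- The integer lift of H: H v is definitionally [ liftH v ].
liftH : ∀ {p} .{{_ : NonZero p}} {m} → Vec (ZMod p) m → ℤ
liftH {p} v = (1ℤ - sumPow v) / + p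

module _ {p : ℕ} .{{_ : NonZero p}} where

  private
    P = + p
    [_]ₚ : ℤ → ZMod p
    [ x ]ₚ = [ x ]

  rep[x]≡x[mod] : ∀ x → rep [ x ]ₚ ≡ x [mod P ]
  rep[x]≡x[mod] x = ≡[mod]-sym (≡[mod] (divides (x /ℕ p) (begin
    x - rep [ x ]ₚ                       ≡⟨ cong (λ r → x - + r) (toℕ-fromℕ< (n%ℕd<d x p)) ⟩
    x - + (x %ℕ p)                       ≡⟨ cong (_- + (x %ℕ p)) (a≡a%ℕn+[a/ℕn]*n x p) ⟩
    + (x %ℕ p) + x /ℕ p * P - + (x %ℕ p) ≡⟨ lemma (+ (x %ℕ p)) (x /ℕ p) P ⟩
    x /ℕ p * P                           ∎)))
    where
      open ≡-Reasoning
      lemma : ∀ r q p → r + q * p - r ≡ q * p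
      lemma = solve-∀

  rep-injective[mod] : ∀ {a b : ZMod p} → rep a ≡ rep b [mod P ] → a ≡ b
  rep-injective[mod] {a} {b} = toℕ-injective ∘ residue-unique (toℕ<n a) (toℕ<n b)

  ≡[mod]⇒[]≡ : ∀ {x y} → x ≡ y [mod P ] → [ x ]ₚ ≡ [ y ]ₚ
  ≡[mod]⇒[]≡ {x} {y} x≡y = rep-injective[mod] (begin
    rep [ x ]ₚ  ≈⟨ rep[x]≡x[mod] x ⟩
    x           ≈⟨ x≡y ⟩
    y           ≈⟨ rep[x]≡x[mod] y ⟨
    rep [ y ]ₚ  ∎)
    where open import Relation.Binary.Reasoning.Setoid (≡[mod]-setoid P)

  []≡⇒≡[mod] : ∀ {x y} → [ x ]ₚ ≡ [ y ]ₚ → x ≡ y [mod P ]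
  []≡⇒≡[mod] {x} {y} [x]≡[y] = begin
    x           ≈⟨ rep[x]≡x[mod] x ⟨
    rep [ x ]ₚ  ≡⟨ cong rep [x]≡[y] ⟩
    rep [ y ]ₚ  ≈⟨ rep[x]≡x[mod] y ⟩
    y           ∎
    where open import Relation.Binary.Reasoning.Setoid (≡[mod]-setoid P)

  []-homo-+ : ∀ x y → [ x + y ]ₚ ≡ [ x ]ₚ ⊕ [ y ]ₚ
  []-homo-+ x y = ≡[mod]⇒[]≡ (+-cong[mod] (≡[mod]-sym (rep[x]≡x[mod] x)) (≡[mod]-sym (rep[x]≡x[mod] y)))

  /-exact : ∀ {x} → x ≡ 0ℤ [mod P ] → x / P * P ≡ x
  /-exact {x} x≡0 = begin
    x / P * P                 ≡⟨ cong (_* P) (div-pos-is-/ℕ x p) ⟩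
    x /ℕ p * P                ≡⟨ ℤP.+-identityˡ _ ⟨
    + 0 + x /ℕ p * P          ≡⟨ cong (λ r → + r + x /ℕ p * P) x%p≡0 ⟨
    + (x %ℕ p) + x /ℕ p * P   ≡⟨ a≡a%ℕn+[a/ℕn]*n x p ⟨
    x                         ∎
    where
      open ≡-Reasoning
      x%p≡0 : x %ℕ p ≡ 0
      x%p≡0 = begin
        x %ℕ p       ≡⟨ toℕ-fromℕ< (n%ℕd<d x p) ⟨
        toℕ [ x ]ₚ   ≡⟨ cong toℕ (≡[mod]⇒[]≡ x≡0) ⟩
        toℕ [ 0ℤ ]ₚ  ≡⟨ toℕ-fromℕ< (n%ℕd<d 0ℤ p) ⟩
        0 ℕ.% p      ≡⟨ m<n⇒m%n≡m (ℕ.>-nonZero⁻¹ p) ⟩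
        0            ∎

  sumPow-map-⊗ : ∀ {m} a (v : Vec (ZMod p) m) → sumPow (map (a ⊗_) v) ≡ rep a ^ p * sumPow v [mod P * P ]
  sumPow-map-⊗ a []      = ≡⇒≡[mod] (sym (ℤP.*-zeroʳ (rep a ^ p)))
  sumPow-map-⊗ a (c ∷ v) = begin
    rep (a ⊗ c) ^ p + sumPow (map (a ⊗_) v)       ≈⟨ +-cong[mod] [ac]ᵖ≡aᵖcᵖ (sumPow-map-⊗ a v) ⟩
    (rep a * rep c) ^ p + rep a ^ p * sumPow v    ≡⟨ cong (_+ rep a ^ p * sumPow v) (^-distrib-* (rep a) (rep c) p) ⟩
    rep a ^ p * rep c ^ p + rep a ^ p * sumPow v  ≡⟨ ℤP.*-distribˡ-+ (rep a ^ p) (rep c ^ p) (sumPow v) ⟨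
    rep a ^ p * (rep c ^ p + sumPow v)            ∎
    where
      open import Relation.Binary.Reasoning.Setoid (≡[mod]-setoid (P * P))
      [ac]ᵖ≡aᵖcᵖ : rep (a ⊗ c) ^ p ≡ (rep a * rep c) ^ p [mod P * P ]
      [ac]ᵖ≡aᵖcᵖ = ^-cong[mod²] p ∣-refl (rep[x]≡x[mod] (rep a * rep c))

  sumPow-compose : ∀ {n} (π : Vec (ZMod p) n) k (γ : (i : Fin n) → Vec (ZMod p) (k i)) →
                   sumPow (compose π k γ) ≡ ∑[ i < n ] (rep (lookup π i) ^ p * sumPow (γ i)) [mod P * P ]
  sumPow-compose []      k γ = ≡⇒≡[mod] refl
  sumPow-compose (a ∷ π) k γ = begin
    sumPow (map (a ⊗_) (γ zero) ++ compose π (k ∘ suc) (γ ∘ suc))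
      ≡⟨ sumPow-++ (map (a ⊗_) (γ zero)) (compose π (k ∘ suc) (γ ∘ suc)) ⟩
    sumPow (map (a ⊗_) (γ zero)) + sumPow (compose π (k ∘ suc) (γ ∘ suc))
      ≈⟨ +-cong[mod] (sumPow-map-⊗ a (γ zero)) (sumPow-compose π (k ∘ suc) (γ ∘ suc)) ⟩
    rep a ^ p * sumPow (γ zero) + ∑[ i < _ ] (rep (lookup π i) ^ p * sumPow (γ (suc i)))  ∎
    where open import Relation.Binary.Reasoning.Setoid (≡[mod]-setoid (P * P))

  module _ (p-prime : Prime p) where

    Σp≡[sumPow] : ∀ {m} (v : Vec (ZMod p) m) → Σp v ≡ [ sumPow v ]ₚ
    Σp≡[sumPow] []      = refl
    Σp≡[sumPow] (a ∷ v) = ≡[mod]⇒[]≡ (+-cong[mod] (≡[mod]-sym (fermat p-prime (toℕ a))) (begin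
      rep (Σp v)         ≡⟨ cong rep (Σp≡[sumPow] v) ⟩
      rep [ sumPow v ]ₚ  ≈⟨ rep[x]≡x[mod] (sumPow v) ⟩
      sumPow v           ∎))
      where open import Relation.Binary.Reasoning.Setoid (≡[mod]-setoid P)

    liftH*P≡1-sumPow : ∀ {m} (v : Vec (ZMod p) m) → InΠ v → liftH v * P ≡ 1ℤ - sumPow v
    liftH*P≡1-sumPow v v∈Π = /-exact (∣⇒≡0[mod] (_≡_[mod_].divides-difference 1≡sumPow))
      where
        1≡sumPow : 1ℤ ≡ sumPow v [mod P ]
        1≡sumPow = ≡[mod]-sym ([]≡⇒≡[mod] {x = sumPow v} {y = 1ℤ} (trans (sym (Σp≡[sumPow] v)) v∈Π))

    liftH-compose : ∀ {n} (π : Vec (ZMod p) n) k (γ : (i : Fin n) → Vec (ZMod p) (k i)) →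
                    InΠ π → (∀ i → InΠ (γ i)) →
                    liftH (compose π k γ) ≡ liftH π + ∑[ i < n ] (rep (lookup π i) ^ p * liftH (γ i)) [mod P ]
    liftH-compose {n} π k γ π∈Π γ∈Π = *-cancelʳ-≡[mod] P (begin
      liftH (compose π k γ) * P    ≡⟨ /-exact 1-S∘≡0 ⟩
      1ℤ - sumPow (compose π k γ)  ≈⟨ 1-S∘≡[lift+W]*P ⟩
      (liftH π + W) * P            ∎)
      where
        open import Relation.Binary.Reasoning.Setoid (≡[mod]-setoid (P * P))
        c b : Fin n → ℤ
        c i = rep (lookup π i) ^ p
        b i = liftH (γ i)
        W = ∑[ i < n ] (c i * b i)
        sumPow≡1-b*P : ∀ i → sumPow (γ i) ≡ 1ℤ - b i * P
        sumPow≡1-b*P i =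
          trans (lemma (sumPow (γ i))) (cong (_-_ 1ℤ) (sym (liftH*P≡1-sumPow (γ i) (γ∈Π i))))
          where lemma : ∀ s → s ≡ 1ℤ - (1ℤ - s)
                lemma = solve-∀
        1-S∘≡[lift+W]*P : 1ℤ - sumPow (compose π k γ) ≡ (liftH π + W) * P [mod P * P ]
        1-S∘≡[lift+W]*P = begin
          1ℤ - sumPow (compose π k γ)             ≈⟨ +-congˡ[mod] 1ℤ (-‿cong[mod] (sumPow-compose π k γ)) ⟩
          1ℤ - ∑[ i < n ] (c i * sumPow (γ i))    ≡⟨ cong (λ s → 1ℤ - s) (sum-cong-≗ (cong (c _ *_) ∘ sumPow≡1-b*P)) ⟩
          1ℤ - ∑[ i < n ] (c i * (1ℤ - b i * P))  ≡⟨ cong (λ s → 1ℤ - s) (∑-complement P c b) ⟩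
          1ℤ - (∑[ i < n ] c i - W * P)           ≡⟨ cong (λ s → 1ℤ - (s - W * P)) (sumPow≡∑ π) ⟨
          1ℤ - (sumPow π - W * P)                 ≡⟨ lemma (sumPow π) (W * P) ⟩
          (1ℤ - sumPow π) + W * P                 ≡⟨ cong (_+ W * P) (liftH*P≡1-sumPow π π∈Π) ⟨
          liftH π * P + W * P                     ≡⟨ ℤP.*-distribʳ-+ P (liftH π) W ⟨
          (liftH π + W) * P                       ∎
          where lemma : ∀ S X → 1ℤ - (S - X) ≡ (1ℤ - S) + X
                lemma = solve-∀
        1-S∘≡0 : 1ℤ - sumPow (compose π k γ) ≡ 0ℤ [mod P ]
        1-S∘≡0 = ≡[mod]-trans (≡[mod]-∣ (∣m⇒∣m*n P ∣-refl) 1-S∘≡[lift+W]*P)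
                              (∣⇒≡0[mod] (divides (liftH π + W) refl))

    [∑]≡Σp : ∀ {n} (π : Vec (ZMod p) n) (b : Fin n → ℤ) →
             [ ∑[ i < n ] (rep (lookup π i) ^ p * b i) ]ₚ ≡ Σp (tabulate (λ i → lookup π i ⊗ [ b i ]))
    [∑]≡Σp []      b = refl
    [∑]≡Σp (a ∷ π) b = trans ([]-homo-+ (rep a ^ p * b zero) _) (cong₂ _⊕_
      (≡[mod]⇒[]≡ (*-cong[mod] (fermat p-prime (toℕ a)) (≡[mod]-sym (rep[x]≡x[mod] (b zero)))))
      ([∑]≡Σp π (b ∘ suc)))

proposition4p1 : (p : ℕ) .{{_ : NonZero p}} → Prime p →
    (n : ℕ) → 1 ≤ n → (k : Fin n → ℕ) → (∀ i → 1 ≤ k i) →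
    (π : Vec (ZMod p) n) → InΠ π →
    (γ : (i : Fin n) → Vec (ZMod p) (k i)) → (∀ i → InΠ (γ i)) →
    H (compose π k γ) ≡ H π ⊕ Σp (tabulate (λ i → lookup π i ⊗ H (γ i)))
proposition4p1 p p-prime n _ k _ π π∈Π γ γ∈Π = begin
  H (compose π k γ)  ≡⟨ ≡[mod]⇒[]≡ (liftH-compose p-prime π k γ π∈Π γ∈Π) ⟩
  [ liftH π + W ]    ≡⟨ []-homo-+ (liftH π) W ⟩
  H π ⊕ [ W ]        ≡⟨ cong (H π ⊕_) ([∑]≡Σp p-prime π (liftH ∘ γ)) ⟩
  H π ⊕ Σp (tabulate (λ i → lookup π i ⊗ H (γ i)))  ∎
  where
    open ≡-Reasoning
    W = ∑[ i < n ] (rep (lookup π i) ^ p * liftH (γ i))
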